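{- Let $n>d\geq k$ be positive integers and let $G(n,d,k)$ be the $n$-vertex graph defined below. Then $G(n,d,k)$ contains no path on $k+1$ vertices. Consequently, $\phi(n,d,k)$ is at least the value given by the following formulas: if $k$ is odd, $\phi(n,d,k)\geq \frac{k-1}{2}q+1$ where $n=q(d+1)+r$, $0\le r\le d$; if $k=2$, $\phi(n,d,2)\ge 1$; if $k=4$, writing $n=2qd+r$ with $0\leq r<2d$, $\phi(n,d,4)\geq 2q+1$ when $r\leq d$ and $\phi(n,d,4)\ge 2q+2$ when $d<r<2d$; if $k\geq 6$ is even, writing $n=q(d+1)+r$ with $0\le r\le d$, $\phi(n,d,k)\geq\frac{k-2}{2}q+1$ when $r\le d-\frac k2$ and $\phi(n,d,k)\geq\frac{k-2}{2}q+2$ when $d-\frac k2<r\le d$.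
   Context: All graphs are finite and simple. For positive integers $n>d\geq k$, $\phi(n,d,k)$ is the smallest integer $\phi$ such that every $n$-vertex graph with at least $\phi$ vertices of degree at least $d$ contains a path on $k+1$ vertices (as a subgraph). $G+H$ denotes the vertex-disjoint union of graphs $G$ and $H$; $m\cdot G$ denotes $m$ vertex-disjoint copies of $G$; $K_m$ is the complete graph on $m$ vertices, $I_m$ the edgeless graph on $m$ vertices, and $K_{1,m}$ the star with $m$ leaves. The graph $H_{d,k}$ is obtained from the disjoint union of $K_{\lfloor\frac{k-1}{2}\rfloor}$ and $I_{d+1-\lfloor\frac{k-1}{2}\rfloor}$ by joining every vertex of the $K_{\lfloor\frac{k-1}{2}\rfloor}$ to every vertex of the $I_{d+1-\lfloor\frac{k-1}{2}\rfloor}$. For even $k\geq 4$, $H^*_{d,k}$ is obtained from $H_{d,k}$ by adding a disjoint copy of $I_{d+1-\frac{k}{2}}$ and joining every vertex of it to one fixed vertex of degree $\frac{k}{2}-1$ in $H_{d,k}$. The graph $G(n,d,k)$ is defined by: for $k\in\{1,2\}$, $G(n,d,k)=I_n$; for $k=4$, writing $n=2qd+r$ with $0\le r<2d$, $G(n,d,4)=q\cdot H^*_{d,4}+I_r$ if $r\leq d$ and $G(n,d,4)=q\cdot H^*_{d,4}+K_{1,d}+I_{r-d-1}$ otherwise; for odd $k\ge 3$, writing $n=q(d+1)+r$ with $0\le r\le d$, $G(n,d,k)=q\cdot H_{d,k}+I_r$; for even $k\geq 6$, writing $n=q(d+1)+r$ with $0\le r\le d$, $G(n,d,k)=q\cdot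 H_{d,k}+I_r$ if $r\leq d-\frac{k}{2}$ and $G(n,d,k)=(q-1)\cdot H_{d,k}+H^*_{d,k}+I_{r-d+\frac{k}{2}-1}$ otherwise. -}

module Defs where

open import Data.Bool using (Bool; true; false; if_then_else_; not; _∧_)
open import Data.Nat using (ℕ; zero; suc; _+_; _*_; _∸_; _≤_; _≤ᵇ_; _≡ᵇ_)
open import Data.Nat.DivMod using (_/_; _%_)
open import Data.Fin using (Fin; splitAt; _↑ʳ_; inject₁)
import Data.Fin as F
open import Data.Sum using (_⊎_; inj₁; inj₂)
open import Data.List using (List; map; allFin)
open import Data.Nat.ListAction using (sum)
open import Relation.Nullary using (yes; no)
open import Data.Empty using (⊥-elim)
open import Data.Product using (Σ; _×_; _,_)
open import Function.Definitions using (Injective)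
open import Relation.Binary.PropositionalEquality using (_≡_; refl; sym)
open import Relation.Nullary.Decidable using (⌊_⌋)

record Graph : Set where
  field
    V     : ℕ
    adj   : Fin V → Fin V → Bool
    adj-sym : ∀ i j → adj i j ≡ adj j i
    adj-irr : ∀ i → adj i i ≡ false
open Graph public

deg : (G : Graph) → Fin (V G) → ℕ
deg G v = sum (map (λ j → if adj G v j then 1 else 0) (allFin (V G)))

#degGE : Graph → ℕ → ℕ
#degGE G d = sum (map (λ v → if d ≤ᵇ deg G v then 1 else 0) (allFin (V G)))

HasPath : Graph → ℕ → Set
HasPath G k = Σ (Fin (suc k) → Fin (V G)) λ f →
  Injective _≡_ _≡_ f × (∀ (i : Fin k) → adj G (f (inject₁ i)) (f (F.suc i)) ≡ true)

-- "every n-vertex graph with at least t vertices of degree ≥ d contains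
-- a path on k+1 vertices";  φ(n,d,k) is the least t with this property.
Forces : ℕ → ℕ → ℕ → ℕ → Set
Forces n d k t = ∀ (G : Graph) → V G ≡ n → t ≤ #degGE G d → HasPath G k

I : ℕ → Graph
I m = record { V = m ; adj = λ _ _ → false ; adj-sym = λ _ _ → refl ; adj-irr = λ _ → refl }

private
  neq : ∀ {m} → Fin m → Fin m → Bool
  neq i j = not ⌊ i F.≟ j ⌋

  neq-sym : ∀ {m} (i j : Fin m) → neq i j ≡ neq j i
  neq-sym i j with i F.≟ j | j F.≟ i
  ... | yes _ | yes _ = refl
  ... | no _ | no _ = refl
  ... | yes p | no q = ⊥-elim (q (sym p))
  ... | no p | yes q = ⊥-elim (p (sym q))

  neq-irr : ∀ {m} (i : Fin m) → neq i i ≡ false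
  neq-irr i with i F.≟ i
  ... | yes _ = refl
  ... | no p = ⊥-elim (p refl)

K : ℕ → Graph
K m = record { V = m ; adj = neq ; adj-sym = neq-sym ; adj-irr = neq-irr }

private
  adjS : (G H : Graph) → (Fin (V G) → Fin (V H) → Bool) →
         Fin (V G) ⊎ Fin (V H) → Fin (V G) ⊎ Fin (V H) → Bool
  adjS G H c (inj₁ x) (inj₁ y) = adj G x y
  adjS G H c (inj₂ x) (inj₂ y) = adj H x y
  adjS G H c (inj₁ x) (inj₂ y) = c x y
  adjS G H c (inj₂ x) (inj₁ y) = c y x

  adjS-sym : ∀ G H c a b → adjS G H c a b ≡ adjS G H c b a
  adjS-sym G H c (inj₁ x) (inj₁ y) = adj-sym G x y
  adjS-sym G H c (inj₂ x) (inj₂ y) = adj-sym H x y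
  adjS-sym G H c (inj₁ x) (inj₂ y) = refl
  adjS-sym G H c (inj₂ x) (inj₁ y) = refl

  adjS-irr : ∀ G H c a → adjS G H c a a ≡ false
  adjS-irr G H c (inj₁ x) = adj-irr G x
  adjS-irr G H c (inj₂ x) = adj-irr H x

glue : (G H : Graph) → (Fin (V G) → Fin (V H) → Bool) → Graph
glue G H c = record
  { V = V G + V H
  ; adj = λ i j → adjS G H c (splitAt (V G) i) (splitAt (V G) j)
  ; adj-sym = λ i j → adjS-sym G H c (splitAt (V G) i) (splitAt (V G) j)
  ; adj-irr = λ i → adjS-irr G H c (splitAt (V G) i)
  }

_⊕_ : Graph → Graph → Graph
G ⊕ H = glue G H (λ _ _ → false)
infixr 5 _⊕_

join : Graph → Graph → Graph
join G H = glue G H (λ _ _ → true)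

attach : (G : Graph) → Fin (V G) → Graph → Graph
attach G v H = glue G H (λ x _ → ⌊ x F.≟ v ⌋)

copies : ℕ → Graph → Graph
copies zero G = I 0
copies (suc m) G = G ⊕ copies m G

star : ℕ → Graph
star m = join (K 1) (I m)

half : ℕ → ℕ
half k = (k ∸ 1) / 2

-- H_{d,k} = K_a joined to I_{d+1-a}, a = ⌊(k-1)/2⌋ (here d+1-a is written
-- suc (d ∸ a), equal to it since a ≤ d whenever k ≤ d)
H : ℕ → ℕ → Graph
H d k = join (K (half k)) (I (suc (d ∸ half k)))

-- H*_{d,k}: attach I_{d+1-k/2} to a vertex of the independent part of
-- H_{d,k} (these are exactly the vertices of degree k/2-1)
Hstar : ℕ → ℕ → Graph
Hstar d k = attach (H d k) (half k ↑ʳ F.zero) (I (suc d ∸ k / 2))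

private
  Gmain : ℕ → ℕ → ℕ → Graph
  Gmain n d k =
    let q = n / suc d ; r = n % suc d in
    if k % 2 ≡ᵇ 1
      then copies q (H d k) ⊕ I r
      else (if r ≤ᵇ d ∸ k / 2
              then copies q (H d k) ⊕ I r
              else copies (q ∸ 1) (H d k) ⊕ Hstar d k ⊕ I ((r + k / 2) ∸ suc d))

  G4 : ℕ → ℕ → Graph
  G4 n d' =
    let D = suc d' ; q = n / (2 * D) ; r = n % (2 * D) in
    if r ≤ᵇ D
      then copies q (Hstar D 4) ⊕ I r
      else copies q (Hstar D 4) ⊕ star D ⊕ I (r ∸ D ∸ 1)

-- (values for k = 0 or d = 0 are irrelevant junk: the theorem assumes
-- n > d ≥ k ≥ 1)
Gndk : ℕ → ℕ → ℕ → Graph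
Gndk n d 0 = I n
Gndk n d 1 = I n
Gndk n d 2 = I n
Gndk n zero k = I n
Gndk n (suc d') 4 = G4 n d'
Gndk n (suc d') k = Gmain n (suc d') k

{-# OPTIONS --safe #-}
-- G(n,d,k) is a disjoint union of copies of H_{d,k} = K_a joined to I_{d+1-a} (a = ⌊(k-1)/2⌋), possibly
-- one H*_{d,k} or star, and isolated vertices. A path never leaves a component; in K_a joined to I_b two
-- consecutive path vertices cannot both lie in I_b, so paths have at most 2a+1 vertices; and pendant
-- leaves attached to one vertex can only be path ends, never both ends. Each H_{d,k} contributes its a
-- vertices of degree d, each H*_{d,k} one more, the star one. So G(n,d,k) has no P_{k+1} but the stated
-- number of vertices of degree ≥ d, and a threshold forcing P_{k+1} must exceed that number.
module Submission where

open import Defs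
open import Data.Bool using (Bool; true; false; if_then_else_; not; T)
open import Data.Empty using (⊥; ⊥-elim)
open import Data.Bool.Properties using (T-≡)
open import Data.Fin.Relation.Unary.Top using (view; ‵fromℕ; ‵inject₁)
open import Data.Fin using (Fin; zero; suc; _↑ˡ_; _↑ʳ_; splitAt; inject₁; fromℕ)
import Data.Fin as Fin
import Data.Fin.Properties as Finₚ
open import Data.List using (map; tabulate)
open import Data.Nat using (ℕ; zero; suc; _+_; _*_; _∸_; _≤_; _<_; _≤ᵇ_; _≡ᵇ_; NonZero; z≤n; s≤s; _≤′_; ≤′-refl; ≤′-step)
open import Data.Nat.ListAction using (sum)
open import Data.Nat.Properties
open import Data.Nat.DivMod
open import Data.Nat.Tactic.RingSolver using (solve-∀)
open import Data.Product using (Σ; ∃; ∃₂; _×_; _,_; proj₁; proj₂)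
open import Data.Sum using (_⊎_; inj₁; inj₂)
open import Data.Unit using (tt)
open import Function using (_∘_; id; case_of_; Equivalence)
open import Function.Definitions using (Injective)
open import Relation.Binary.PropositionalEquality
  using (_≡_; _≢_; refl; sym; trans; cong; cong₂; subst; subst₂; module ≡-Reasoning)
open import Relation.Nullary using (¬_; Dec; yes; no)
open import Relation.Nullary.Decidable using (⌊_⌋; fromWitness; toWitness)

-- Arithmetic

divMod-unique : ∀ {n d q r} .{{_ : NonZero d}} → n ≡ q * d + r → r < d → n / d ≡ q × n % d ≡ r
divMod-unique {d = d} {q} {r} refl r<d = quotient , remainder
  where
  remainder : (q * d + r) % d ≡ r
  remainder = trans (cong (_% d) (+-comm (q * d) r)) (trans ([m+kn]%n≡m%n r q d) (m<n⇒m%n≡m r<d))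
  quotient : (q * d + r) / d ≡ q
  quotient = begin
    (q * d + r) / d     ≡⟨ +-distrib-/ (q * d) r (subst (_< d) (cong₂ _+_ (sym (m*n%n≡0 q d)) (sym (m<n⇒m%n≡m r<d))) r<d) ⟩
    q * d / d + r / d   ≡⟨ cong₂ _+_ (m*n/n≡m q d) (m<n⇒m/n≡0 r<d) ⟩
    q + 0               ≡⟨ +-identityʳ q ⟩
    q                   ∎
    where open ≡-Reasoning

divMod-subst : ∀ {n d q r} .{{_ : NonZero d}} (P : ℕ → ℕ → Set) → n ≡ q * d + r → r < d → P (n / d) (n % d) → P q r
divMod-subst {q = q} P n≡ r<d = subst₂ P (proj₁ (divMod-unique {q = q} n≡ r<d)) (proj₂ (divMod-unique {q = q} n≡ r<d))

m≡[m/n]*n+m%n : ∀ n d .{{_ : NonZero d}} → n ≡ n / d * d + n % d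
m≡[m/n]*n+m%n n d = trans (m≡m%n+[m/n]*n n d) (+-comm (n % d) _)

data Parity : ℕ → Set where
  even : ∀ m → Parity (2 * m)
  odd  : ∀ m → Parity (2 * m + 1)

parity : ∀ k → Parity k
parity zero = even 0
parity (suc k) with parity k
... | even m = subst Parity (+-comm (2 * m) 1) (odd m)
... | odd m  = subst Parity (2*[1+m]≡[2*m+1]+1 m) (even (suc m))
  where
  2*[1+m]≡[2*m+1]+1 : ∀ m → 2 * suc m ≡ suc (2 * m + 1)
  2*[1+m]≡[2*m+1]+1 = solve-∀

2*m≡m*2+0 : ∀ m → 2 * m ≡ m * 2 + 0
2*m≡m*2+0 m = trans (*-comm 2 m) (sym (+-identityʳ _))

2*m/2≡m : ∀ m → 2 * m / 2 ≡ m
2*m/2≡m m = proj₁ (divMod-unique {q = m} (2*m≡m*2+0 m) (s≤s z≤n))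

2*m%2≡0 : ∀ m → 2 * m % 2 ≡ 0
2*m%2≡0 m = proj₂ (divMod-unique {q = m} (2*m≡m*2+0 m) (s≤s z≤n))

[2*m+1]%2≡1 : ∀ m → (2 * m + 1) % 2 ≡ 1
[2*m+1]%2≡1 m = proj₂ (divMod-unique {q = m} (cong (_+ 1) (*-comm 2 m)) ≤-refl)

2*[1+m]∸1≡m*2+1 : ∀ m → 2 * suc m ∸ 1 ≡ m * 2 + 1
2*[1+m]∸1≡m*2+1 m = cong (_∸ 1) (2*[1+m]≡1+[m*2+1] m)
  where
  2*[1+m]≡1+[m*2+1] : ∀ m → 2 * suc m ≡ suc (m * 2 + 1)
  2*[1+m]≡1+[m*2+1] = solve-∀

half-odd : ∀ m → half (2 * m + 1) ≡ m
half-odd m = trans (cong (_/ 2) (m+n∸n≡m (2 * m) 1)) (2*m/2≡m m)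

half-even : ∀ m → half (2 * m) ≡ m ∸ 1
half-even zero    = refl
half-even (suc m) = proj₁ (divMod-unique {q = m} (2*[1+m]∸1≡m*2+1 m) ≤-refl)

2*q*[1+d]≡q*[2*[1+d]] : ∀ q d → 2 * q * suc d ≡ q * (2 * suc d)
2*q*[1+d]≡q*[2*[1+d]] = solve-∀

q*[2+d+d]≡2*q*[1+d] : ∀ q d → q * (suc (suc d) + d) ≡ 2 * q * suc d
q*[2+d+d]≡2*q*[1+d] = solve-∀

half-≤ : ∀ k → half k ≤ k
half-≤ k = ≤-trans (m/n≤m (k ∸ 1) 2) (m∸n≤m k 1)

[a∸m]+[r+m∸a]≡r : ∀ {m a r} → m ≤ a → a ≤ r + m → (a ∸ m) + (r + m ∸ a) ≡ r
[a∸m]+[r+m∸a]≡r {m} {a} {r} m≤a a≤r+m = +-cancelʳ-≡ m _ r (begin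
  (a ∸ m) + (r + m ∸ a) + m   ≡⟨ cong (_+ m) (+-comm (a ∸ m) _) ⟩
  (r + m ∸ a) + (a ∸ m) + m   ≡⟨ +-assoc (r + m ∸ a) (a ∸ m) m ⟩
  (r + m ∸ a) + (a ∸ m + m)   ≡⟨ cong ((r + m ∸ a) +_) (m∸n+n≡m m≤a) ⟩
  (r + m ∸ a) + a             ≡⟨ m∸n+n≡m a≤r+m ⟩
  r + m                       ∎)
  where open ≡-Reasoning

-- Counting

count : (n : ℕ) → (Fin n → Bool) → ℕ
count zero    p = 0
count (suc n) p = (if p zero then 1 else 0) + count n (p ∘ suc)

sum-map-tabulate : ∀ {A : Set} n (p : A → Bool) (f : Fin n → A) →
                   sum (map (λ x → if p x then 1 else 0) (tabulate f)) ≡ count n (p ∘ f)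
sum-map-tabulate zero    p f = refl
sum-map-tabulate (suc n) p f = cong (_ +_) (sum-map-tabulate n p (f ∘ suc))

deg≡count : ∀ G v → deg G v ≡ count (V G) (adj G v)
deg≡count G v = sum-map-tabulate (V G) (adj G v) id

#degGE≡count : ∀ G d → #degGE G d ≡ count (V G) (λ v → d ≤ᵇ deg G v)
#degGE≡count G d = sum-map-tabulate (V G) (λ v → d ≤ᵇ deg G v) id

count-++ : ∀ m n (p : Fin (m + n) → Bool) →
           count (m + n) p ≡ count m (p ∘ (_↑ˡ n)) + count n (p ∘ (m ↑ʳ_))
count-++ zero    n p = refl
count-++ (suc m) n p = trans (cong (b +_) (count-++ m n (p ∘ suc))) (sym (+-assoc b _ _))
  where b = if p zero then 1 else 0

count-cong : ∀ n {p q : Fin n → Bool} → (∀ i → p i ≡ q i) → count n p ≡ count n q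
count-cong zero    p≗q = refl
count-cong (suc n) p≗q = cong₂ _+_ (cong (λ b → if b then 1 else 0) (p≗q zero)) (count-cong n (p≗q ∘ suc))

count-mono : ∀ n {p q : Fin n → Bool} → (∀ i → T (p i) → T (q i)) → count n p ≤ count n q
count-mono zero    p⇒q = z≤n
count-mono (suc n) {p} {q} p⇒q = +-mono-≤ (head (p zero) (q zero) (p⇒q zero)) (count-mono n (p⇒q ∘ suc))
  where
  head : ∀ b c → (T b → T c) → (if b then 1 else 0) ≤ (if c then 1 else 0)
  head true  true  _ = s≤s z≤n
  head true  false f with f tt
  ... | ()
  head false c     _ = z≤n

count-true : ∀ n → count n (λ _ → true) ≡ n
count-true zero    = refl
count-true (suc n) = cong suc (count-true n)

count-false : ∀ n → count n (λ _ → false) ≡ 0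
count-false zero    = refl
count-false (suc n) = count-false n

count-all : ∀ n {p : Fin n → Bool} → (∀ i → T (p i)) → n ≤ count n p
count-all n {p} all = subst (_≤ count n p) (count-true n) (count-mono n (λ i _ → all i))

count-head : ∀ n (p : Fin (suc n) → Bool) → T (p zero) → 1 ≤ count (suc n) p
count-head n p t with p zero
... | true = s≤s z≤n

count-≢ : ∀ m (i : Fin (suc m)) → count (suc m) (λ j → not ⌊ i Fin.≟ j ⌋) ≡ m
count-≢ m       zero    = count-true m
count-≢ (suc m) (suc i) = cong suc (trans (count-cong (suc m) (λ j → cong not (≟-suc i j))) (count-≢ m i))
  where
  ≟-suc : ∀ {n} (i j : Fin n) → ⌊ suc i Fin.≟ suc j ⌋ ≡ ⌊ i Fin.≟ j ⌋
  ≟-suc i j with i Fin.≟ j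
  ... | yes _ = refl
  ... | no _  = refl

-- Glued graphs

Left : ∀ {m} n → Fin (m + n) → Set
Left {m} n i = Σ (Fin m) λ x → i ≡ x ↑ˡ n

Right : ∀ m {n} → Fin (m + n) → Set
Right m {n} i = Σ (Fin n) λ y → i ≡ m ↑ʳ y

side : ∀ m n (i : Fin (m + n)) → Left n i ⊎ Right m i
side m n i with splitAt m i in eq
... | inj₁ x = inj₁ (x , sym (Finₚ.splitAt⁻¹-↑ˡ eq))
... | inj₂ y = inj₂ (y , sym (Finₚ.splitAt⁻¹-↑ʳ eq))

module _ (G H : Graph) (c : Fin (V G) → Fin (V H) → Bool) where

  private
    A = glue G H c

  adj-glue-ˡˡ : ∀ x y → adj A (x ↑ˡ V H) (y ↑ˡ V H) ≡ adj G x y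
  adj-glue-ˡˡ x y rewrite Finₚ.splitAt-↑ˡ (V G) x (V H) | Finₚ.splitAt-↑ˡ (V G) y (V H) = refl

  adj-glue-ˡʳ : ∀ x y → adj A (x ↑ˡ V H) (V G ↑ʳ y) ≡ c x y
  adj-glue-ˡʳ x y rewrite Finₚ.splitAt-↑ˡ (V G) x (V H) | Finₚ.splitAt-↑ʳ (V G) (V H) y = refl

  adj-glue-ʳˡ : ∀ x y → adj A (V G ↑ʳ y) (x ↑ˡ V H) ≡ c x y
  adj-glue-ʳˡ x y = trans (adj-sym A _ _) (adj-glue-ˡʳ x y)

  adj-glue-ʳʳ : ∀ x y → adj A (V G ↑ʳ x) (V G ↑ʳ y) ≡ adj H x y
  adj-glue-ʳʳ x y rewrite Finₚ.splitAt-↑ʳ (V G) (V H) x | Finₚ.splitAt-↑ʳ (V G) (V H) y = refl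

  deg-glue-ˡ : ∀ x → deg A (x ↑ˡ V H) ≡ deg G x + count (V H) (c x)
  deg-glue-ˡ x = begin
    deg A (x ↑ˡ V H)                                                        ≡⟨ deg≡count A _ ⟩
    count (V G + V H) (adj A (x ↑ˡ V H))                                    ≡⟨ count-++ (V G) (V H) _ ⟩
    count (V G) (adj A (x ↑ˡ V H) ∘ (_↑ˡ V H)) + count (V H) (adj A (x ↑ˡ V H) ∘ (V G ↑ʳ_))
      ≡⟨ cong₂ _+_ (count-cong (V G) (adj-glue-ˡˡ x)) (count-cong (V H) (adj-glue-ˡʳ x)) ⟩
    count (V G) (adj G x) + count (V H) (c x)                               ≡⟨ cong (_+ _) (deg≡count G x) ⟨
    deg G x + count (V H) (c x)                                             ∎
    where open ≡-Reasoning

  deg-glue-ʳ : ∀ y → deg A (V G ↑ʳ y) ≡ count (V G) (λ x → c x y) + deg H y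
  deg-glue-ʳ y = begin
    deg A (V G ↑ʳ y)                                                        ≡⟨ deg≡count A _ ⟩
    count (V G + V H) (adj A (V G ↑ʳ y))                                    ≡⟨ count-++ (V G) (V H) _ ⟩
    count (V G) (adj A (V G ↑ʳ y) ∘ (_↑ˡ V H)) + count (V H) (adj A (V G ↑ʳ y) ∘ (V G ↑ʳ_))
      ≡⟨ cong₂ _+_ (count-cong (V G) (λ x → adj-glue-ʳˡ x y)) (count-cong (V H) (adj-glue-ʳʳ y)) ⟩
    count (V G) (λ x → c x y) + count (V H) (adj H y)                       ≡⟨ cong (_ +_) (deg≡count H y) ⟨
    count (V G) (λ x → c x y) + deg H y                                     ∎
    where open ≡-Reasoning

  deg-glue-ˡ-≥ : ∀ x → deg G x ≤ deg A (x ↑ˡ V H)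
  deg-glue-ˡ-≥ x = subst (deg G x ≤_) (sym (deg-glue-ˡ x)) (m≤m+n _ _)

  #degGE-glue : ∀ d → #degGE A d ≡ count (V G) (λ x → d ≤ᵇ deg A (x ↑ˡ V H))
                                   + count (V H) (λ y → d ≤ᵇ deg A (V G ↑ʳ y))
  #degGE-glue d = trans (#degGE≡count A d) (count-++ (V G) (V H) _)

  #degGE-glue-ˡ : ∀ d → count (V G) (λ x → d ≤ᵇ deg A (x ↑ˡ V H)) ≤ #degGE A d
  #degGE-glue-ˡ d = ≤-trans (m≤m+n _ _) (≤-reflexive (sym (#degGE-glue d)))

#degGE-⊕ : ∀ G H d → #degGE (G ⊕ H) d ≡ #degGE G d + #degGE H d
#degGE-⊕ G H d = begin
  #degGE (G ⊕ H) d                   ≡⟨ #degGE-glue G H _ d ⟩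
  count (V G) (λ x → d ≤ᵇ deg (G ⊕ H) (x ↑ˡ V H)) + count (V H) (λ y → d ≤ᵇ deg (G ⊕ H) (V G ↑ʳ y))
    ≡⟨ cong₂ _+_ (count-cong (V G) (λ x → cong (d ≤ᵇ_) degˡ)) (count-cong (V H) (λ y → cong (d ≤ᵇ_) degʳ)) ⟩
  count (V G) (λ x → d ≤ᵇ deg G x) + count (V H) (λ y → d ≤ᵇ deg H y)
    ≡⟨ cong₂ _+_ (#degGE≡count G d) (#degGE≡count H d) ⟨
  #degGE G d + #degGE H d            ∎
  where
  open ≡-Reasoning
  degˡ : ∀ {x} → deg (G ⊕ H) (x ↑ˡ V H) ≡ deg G x
  degˡ {x} = trans (deg-glue-ˡ G H _ x) (trans (cong (deg G x +_) (count-false (V H))) (+-identityʳ _))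
  degʳ : ∀ {y} → deg (G ⊕ H) (V G ↑ʳ y) ≡ deg H y
  degʳ {y} = trans (deg-glue-ʳ G H _ y) (cong (_+ deg H y) (count-false (V G)))

deg-join-K-I-ˡ : ∀ {a b d} (x : Fin a) → d < a + b → d ≤ deg (join (K a) (I b)) (x ↑ˡ b)
deg-join-K-I-ˡ {suc a} {b} {d} x (s≤s d≤a+b) = subst (d ≤_) (sym degree) d≤a+b
  where
  degree : deg (join (K (suc a)) (I b)) (x ↑ˡ b) ≡ a + b
  degree = trans (deg-glue-ˡ (K (suc a)) (I b) _ x)
                 (cong₂ _+_ (trans (deg≡count (K (suc a)) x) (count-≢ a x)) (count-true b))

deg-join-K-I-ʳ : ∀ {a b} (y : Fin b) → deg (join (K a) (I b)) (a ↑ʳ y) ≡ a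
deg-join-K-I-ʳ {a} {b} y = begin
  deg (join (K a) (I b)) (a ↑ʳ y)       ≡⟨ deg-glue-ʳ (K a) (I b) _ y ⟩
  count a (λ _ → true) + deg (I b) y    ≡⟨ cong₂ _+_ (count-true a) (trans (deg≡count (I b) y) (count-false b)) ⟩
  a + 0                                 ≡⟨ +-identityʳ a ⟩
  a                                     ∎
  where open ≡-Reasoning

#degGE-join-K-I : ∀ {a b d} → d < a + b → a ≤ #degGE (join (K a) (I b)) d
#degGE-join-K-I {a} {b} {d} d<a+b =
  ≤-trans (count-all a (λ x → ≤⇒≤ᵇ (deg-join-K-I-ˡ x d<a+b))) (#degGE-glue-ˡ (K a) (I b) _ d)

#degGE-attach : ∀ {a b ℓ d} → d < a + suc b → d ≤ a + ℓ →
                suc a ≤ #degGE (attach (join (K a) (I (suc b))) (a ↑ʳ zero) (I ℓ)) d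
#degGE-attach {a} {b} {ℓ} {d} d<a+b d≤a+ℓ = ≤-trans centre+K (#degGE-glue-ˡ J (I ℓ) c d)
  where
  J = join (K a) (I (suc b))
  v = a ↑ʳ zero
  c : Fin (V J) → Fin ℓ → Bool
  c x _ = ⌊ x Fin.≟ v ⌋
  A = attach J v (I ℓ)
  high : Fin (V J) → Bool
  high x = d ≤ᵇ deg A (x ↑ˡ ℓ)
  centre : d ≤ deg A (v ↑ˡ ℓ)
  centre = ≤-trans d≤a+ℓ (subst (_≤ deg A (v ↑ˡ ℓ)) (cong (_+ ℓ) (deg-join-K-I-ʳ zero))
             (subst (deg J v + ℓ ≤_) (sym (deg-glue-ˡ J (I ℓ) c v))
               (+-monoʳ-≤ (deg J v) (count-all ℓ (λ _ → fromWitness refl)))))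
  centre+K : suc a ≤ count (a + suc b) high
  centre+K = subst₂ _≤_ (+-comm a 1) (sym (count-++ a (suc b) high))
    (+-mono-≤ (count-all a (λ x → ≤⇒≤ᵇ (≤-trans (deg-join-K-I-ˡ x d<a+b) (deg-glue-ˡ-≥ J (I ℓ) c _))))
              (count-head b (high ∘ (a ↑ʳ_)) (≤⇒≤ᵇ centre)))

-- Paths

IsPath : (G : Graph) (k : ℕ) → (Fin (suc k) → Fin (V G)) → Set
IsPath G k f = Injective _≡_ _≡_ f × (∀ (i : Fin k) → adj G (f (inject₁ i)) (f (suc i)) ≡ true)

module _ {G : Graph} {k : ℕ} {f : Fin (suc (suc k)) → Fin (V G)} where

  IsPath-init : IsPath G (suc k) f → IsPath G k (f ∘ inject₁)
  IsPath-init (inj , edge) = Finₚ.inject₁-injective ∘ inj , edge ∘ inject₁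

  IsPath-tail : IsPath G (suc k) f → IsPath G k (f ∘ suc)
  IsPath-tail (inj , edge) = Finₚ.suc-injective ∘ inj , edge ∘ suc

HasPath-≤ : ∀ {G j k} → j ≤ k → HasPath G k → HasPath G j
HasPath-≤ {G} {j} j≤k = shorten (≤⇒≤′ j≤k)
  where
  shorten : ∀ {k} → j ≤′ k → HasPath G k → HasPath G j
  shorten ≤′-refl        p           = p
  shorten (≤′-step j≤′k) (f , path) = shorten j≤′k (f ∘ inject₁ , IsPath-init {G} path)

I-pathFree : ∀ {n k} → ¬ HasPath (I n) (suc k)
I-pathFree (_ , _ , edge) with edge zero
... | ()

I₀-pathFree : ∀ {k} → ¬ HasPath (I 0) k
I₀-pathFree (f , _) with f zero
... | ()

walk-closed : ∀ G (S : Fin (V G) → Set) → (∀ {u w} → adj G u w ≡ true → S u → S w) →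
              ∀ {k} (f : Fin (suc k) → Fin (V G)) →
              (∀ (i : Fin k) → adj G (f (inject₁ i)) (f (suc i)) ≡ true) →
              S (f zero) → ∀ i → S (f i)
walk-closed G S closed         f edge s zero    = s
walk-closed G S closed {suc k} f edge s (suc i) =
  walk-closed G S closed (f ∘ suc) (edge ∘ suc) (closed (edge zero) s) i

HasPath-pullback : ∀ {G A : Graph} (h : Fin (V G) → Fin (V A)) → (∀ x y → adj A (h x) (h y) ≡ adj G x y) →
                   ∀ {k f} → IsPath A k f → (∀ i → Σ (Fin (V G)) λ x → f i ≡ h x) → HasPath G k
HasPath-pullback {G} {A} h h-adj {k} {f} (inj , edge) lift = g , g-inj , g-edge
  where
  g : Fin (suc k) → Fin (V G)
  g = proj₁ ∘ lift
  f≡hg : ∀ i → f i ≡ h (g i)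
  f≡hg = proj₂ ∘ lift
  g-inj : Injective _≡_ _≡_ g
  g-inj {i} {j} eq = inj (trans (f≡hg i) (trans (cong h eq) (sym (f≡hg j))))
  g-edge : ∀ i → adj G (g (inject₁ i)) (g (suc i)) ≡ true
  g-edge i = trans (sym (h-adj _ _)) (subst₂ (λ u w → adj A u w ≡ true) (f≡hg _) (f≡hg _) (edge i))

module _ {G H : Graph} where

  ⊕-closedˡ : ∀ {u w} → adj (G ⊕ H) u w ≡ true → Left (V H) u → Left (V H) w
  ⊕-closedˡ {w = w} e (x , refl) with side (V G) (V H) w
  ... | inj₁ l         = l
  ... | inj₂ (y , refl) with trans (sym (adj-glue-ˡʳ G H _ x y)) e
  ...   | ()

  ⊕-closedʳ : ∀ {u w} → adj (G ⊕ H) u w ≡ true → Right (V G) u → Right (V G) w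
  ⊕-closedʳ {w = w} e (y , refl) with side (V G) (V H) w
  ... | inj₂ r         = r
  ... | inj₁ (x , refl) with trans (sym (adj-glue-ʳˡ G H _ x y)) e
  ...   | ()

  ⊕-pathFree : ∀ {k} → ¬ HasPath G k → ¬ HasPath H k → ¬ HasPath (G ⊕ H) k
  ⊕-pathFree ¬G ¬H (f , path@(_ , edge)) with side (V G) (V H) (f zero)
  ... | inj₁ l = ¬G (HasPath-pullback {G} {G ⊕ H} (_↑ˡ V H) (adj-glue-ˡˡ G H _) path
                       (walk-closed (G ⊕ H) (Left (V H)) ⊕-closedˡ f edge l))
  ... | inj₂ r = ¬H (HasPath-pullback {H} {G ⊕ H} (V G ↑ʳ_) (adj-glue-ʳʳ G H _) path
                       (walk-closed (G ⊕ H) (Right (V G)) ⊕-closedʳ f edge r))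

-- pairEdge i is the path edge from position 2i to 2i+1, and pairOf p = ⌊p/2⌋.
pairEdge : ∀ {a} → Fin (suc a) → Fin (suc (a * 2))
pairEdge {zero}  zero    = zero
pairEdge {suc a} zero    = zero
pairEdge {suc a} (suc i) = suc (suc (pairEdge i))

pairOf : ∀ {a} → Fin (suc (suc (a * 2))) → Fin (suc a)
pairOf {zero}  _             = zero
pairOf {suc a} zero          = zero
pairOf {suc a} (suc zero)    = zero
pairOf {suc a} (suc (suc p)) = suc (pairOf p)

pairOf-inject₁ : ∀ {a} (i : Fin (suc a)) → pairOf (inject₁ (pairEdge i)) ≡ i
pairOf-inject₁ {zero}  zero    = refl
pairOf-inject₁ {suc a} zero    = refl
pairOf-inject₁ {suc a} (suc i) = cong suc (pairOf-inject₁ i)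

pairOf-suc : ∀ {a} (i : Fin (suc a)) → pairOf (suc (pairEdge i)) ≡ i
pairOf-suc {zero}  zero    = refl
pairOf-suc {suc a} zero    = refl
pairOf-suc {suc a} (suc i) = cong suc (pairOf-suc i)

-- The a+1 disjoint path edges {2i, 2i+1} each meet K a, since I b is independent; by pigeonhole two of
-- them would share a vertex.
join-K-I-pathFree : ∀ {a b j} → a * 2 < j → ¬ HasPath (join (K a) (I b)) j
join-K-I-pathFree {a} {b} a*2<j p = long (HasPath-≤ {J} a*2<j p)
  where
  J = join (K a) (I b)
  long : ¬ HasPath J (suc (a * 2))
  long (f , inj , edge) = noRepeat (Finₚ.pigeonhole (n<1+n a) label)
    where
    cliqueVertex : ∀ i → Σ (Fin (suc (suc (a * 2)))) λ p → pairOf p ≡ i × Left b (f p)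
    cliqueVertex i with side a b (f (inject₁ (pairEdge i))) | side a b (f (suc (pairEdge i)))
    ... | inj₁ l | _      = inject₁ (pairEdge i) , pairOf-inject₁ i , l
    ... | inj₂ _ | inj₁ l = suc (pairEdge i) , pairOf-suc i , l
    ... | inj₂ (y , eq) | inj₂ (y′ , eq′)
      with trans (sym (adj-glue-ʳʳ (K a) (I b) _ y y′)) (subst₂ (λ u w → adj J u w ≡ true) eq eq′ (edge _))
    ...   | ()
    label : Fin (suc a) → Fin a
    label = proj₁ ∘ proj₂ ∘ proj₂ ∘ cliqueVertex
    noRepeat : ¬ (∃₂ λ i j → i Fin.< j × label i ≡ label j)
    noRepeat (i , j , i<j , same) with cliqueVertex i | cliqueVertex j
    ... | p , pᵢ , x , fp | p′ , pⱼ , x′ , fp′ = Finₚ.<-irrefl (trans (sym pᵢ) (trans (cong pairOf p≡p′) pⱼ)) i<j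
      where
      p≡p′ : p ≡ p′
      p≡p′ = inj (trans fp (trans (cong (_↑ˡ b) same) (sym fp′)))

inject₁²≢suc² : ∀ {n} (i : Fin n) → inject₁ (inject₁ i) ≢ suc (suc i)
inject₁²≢suc² zero    ()
inject₁²≢suc² (suc i) eq = inject₁²≢suc² i (Finₚ.suc-injective eq)

module _ (G : Graph) (v : Fin (V G)) (ℓ : ℕ) where

  private
    A = attach G v (I ℓ)
    c : Fin (V G) → Fin ℓ → Bool
    c x _ = ⌊ x Fin.≟ v ⌋

  leaf-neighbour : ∀ {u w} → Right (V G) u → adj A u w ≡ true → w ≡ v ↑ˡ ℓ
  leaf-neighbour {w = w} (y , refl) e with side (V G) ℓ w
  ... | inj₁ (x , refl) = cong (_↑ˡ ℓ) (toWitness (Equivalence.from T-≡ (trans (sym (adj-glue-ʳˡ G (I ℓ) c x y)) e)))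
  ... | inj₂ (y′ , refl) with trans (sym (adj-glue-ʳʳ G (I ℓ) c y y′)) e
  ...   | ()

  attach-pathFree : ∀ {j} → ¬ HasPath G (suc (suc j)) → ¬ HasPath A (suc (suc (suc j)))
  attach-pathFree {j} ¬G (f , path@(inj , edge)) = byEnds (side (V G) ℓ (f zero)) (side (V G) ℓ (f (fromℕ _)))
    where
    inner : ∀ i → Left ℓ (f (suc (inject₁ i)))
    inner i with side (V G) ℓ (f (suc (inject₁ i)))
    ... | inj₁ l    = l
    ... | inj₂ leaf = ⊥-elim (inject₁²≢suc² i (inj (trans (leaf-neighbour leaf (trans (adj-sym A _ _) (edge (inject₁ i))))
                                                           (sym (leaf-neighbour leaf (edge (suc i)))))))
    allButFirst : Left ℓ (f (fromℕ _)) → ∀ i → Left ℓ (f (suc i))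
    allButFirst last i with view i
    ... | ‵fromℕ      = last
    ... | ‵inject₁ i′ = inner i′
    pullback : ∀ {k g} → IsPath A k g → (∀ i → Left ℓ (g i)) → HasPath G k
    pullback = HasPath-pullback {G} {A} (_↑ˡ ℓ) (adj-glue-ˡˡ G (I ℓ) c)
    byEnds : Left ℓ (f zero) ⊎ Right (V G) (f zero) → Left ℓ (f (fromℕ _)) ⊎ Right (V G) (f (fromℕ _)) → ⊥
    byEnds (inj₂ first) (inj₂ last) =
      case inj (trans (leaf-neighbour first (edge zero))
                      (sym (leaf-neighbour last (trans (adj-sym A _ _) (edge (fromℕ _)))))) of λ ()
    byEnds (inj₂ _) (inj₁ last) = ¬G (pullback (IsPath-tail {A} path) (allButFirst last))
    byEnds (inj₁ first) (inj₂ _) = ¬G (pullback (IsPath-init {A} path) λ { zero → first ; (suc i) → inner i })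
    byEnds (inj₁ first) (inj₁ last) =
      ¬G (HasPath-≤ {G} (n≤1+n _) (pullback path λ { zero → first ; (suc i) → allButFirst last i }))

Hstar-pathFree : ∀ {d k} → 3 ≤ k → half k * 2 < k ∸ 1 → ¬ HasPath (Hstar d k) k
Hstar-pathFree {d} {k} (s≤s (s≤s (s≤s _))) short =
  attach-pathFree (H d k) (half k ↑ʳ zero) (suc d ∸ k / 2) (join-K-I-pathFree {half k} short)

-- Witnesses

-- G witnesses φ(n,d,k) > c.
record Witness (n d k c : ℕ) (G : Graph) : Set where
  field
    order    : V G ≡ n
    pathFree : ¬ HasPath G k
    rich     : c ≤ #degGE G d

exceeds : ∀ {n d k c t G} → Witness n d k c G → Forces n d k t → c + 1 ≤ t
exceeds {c = c} {t} {G} w forces =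
  subst (_≤ t) (+-comm 1 c) (≰⇒> λ t≤c → pathFree (forces G order (≤-trans t≤c rich)))
  where open Witness w

Witness-cast : ∀ {n n′ d k c c′ G} → n ≡ n′ → c′ ≤ c → Witness n d k c G → Witness n′ d k c′ G
Witness-cast n≡n′ c′≤c w = record { order = trans order n≡n′ ; pathFree = pathFree ; rich = ≤-trans c′≤c rich }
  where open Witness w

Witness-⊕ : ∀ {n₁ n₂ d k c₁ c₂ G₁ G₂} → Witness n₁ d k c₁ G₁ → Witness n₂ d k c₂ G₂ →
            Witness (n₁ + n₂) d k (c₁ + c₂) (G₁ ⊕ G₂)
Witness-⊕ {d = d} {G₁ = G₁} {G₂} w₁ w₂ = record
  { order    = cong₂ _+_ (order w₁) (order w₂)
  ; pathFree = ⊕-pathFree (pathFree w₁) (pathFree w₂)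
  ; rich     = subst (_ ≤_) (sym (#degGE-⊕ G₁ G₂ d)) (+-mono-≤ (rich w₁) (rich w₂))
  }
  where open Witness

Witness-copies : ∀ {n d k c G} q → Witness n d k c G → Witness (q * n) d k (q * c) (copies q G)
Witness-copies zero    w = record { order = refl ; pathFree = I₀-pathFree ; rich = z≤n }
Witness-copies (suc q) w = Witness-⊕ w (Witness-copies q w)

I-witness : ∀ {n d k} → Witness n d (suc k) 0 (I n)
I-witness = record { order = refl ; pathFree = I-pathFree ; rich = z≤n }

star-witness : ∀ {d k} → 3 ≤ k → Witness (suc d) d k 1 (star d)
star-witness {d} 3≤k = record { order = refl ; pathFree = join-K-I-pathFree {1} 3≤k ; rich = #degGE-join-K-I {1} {d} ≤-refl }

V-H : ∀ {d k} → half k ≤ d → V (H d k) ≡ suc d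
V-H h≤d = trans (+-suc _ _) (cong suc (m+[n∸m]≡n h≤d))

H-witness : ∀ {d k} → 1 ≤ k → half k ≤ d → Witness (suc d) d k (half k) (H d k)
H-witness {d} {suc k} _ h≤d = record
  { order    = V-H {d} {suc k} h≤d
  ; pathFree = join-K-I-pathFree {half (suc k)} (s≤s (m/n*n≤m k 2))
  ; rich     = #degGE-join-K-I {half (suc k)} (≤-reflexive (sym (V-H {d} {suc k} h≤d)))
  }

Hstar-witness : ∀ {d m} → 2 ≤ m → m ≤ suc d → Witness (suc d + (suc d ∸ m)) d (2 * m) m (Hstar d (2 * m))
Hstar-witness {d} {m@(suc m′)} 2≤m (s≤s m′≤d) = record
  { order    = cong₂ _+_ (V-H {d} {2 * m} half≤d) (cong (suc d ∸_) (2*m/2≡m m))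
  ; pathFree = Hstar-pathFree (≤-trans (n≤1+n 3) (*-monoʳ-≤ 2 2≤m)) short
  ; rich     = subst (_≤ #degGE (Hstar d (2 * m)) d) (cong suc (half-even m))
                 (#degGE-attach {half (2 * m)} (≤-reflexive (sym (V-H {d} {2 * m} half≤d))) centre)
  }
  where
  half≤d : half (2 * m) ≤ d
  half≤d = subst (_≤ d) (sym (half-even m)) m′≤d
  short : half (2 * m) * 2 < 2 * m ∸ 1
  short = subst₂ _<_ (cong (_* 2) (sym (half-even m))) (sym (2*[1+m]∸1≡m*2+1 m′)) (m<m+n (m′ * 2) (s≤s z≤n))
  centre : d ≤ half (2 * m) + (suc d ∸ 2 * m / 2)
  centre = ≤-reflexive (sym (trans (cong₂ (λ a b → a + (suc d ∸ b)) (half-even m) (2*m/2≡m m)) (m+[n∸m]≡n m′≤d)))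

-- The graphs G(n,d,k)

if-T : ∀ {A : Set} {b} {x y : A} → T b → (if b then x else y) ≡ x
if-T {b = true} _ = refl

if-¬T : ∀ {A : Set} {b} {x y : A} → ¬ T b → (if b then x else y) ≡ y
if-¬T {b = true}  ¬t = ⊥-elim (¬t tt)
if-¬T {b = false} _  = refl

Gndk-odd : ∀ {n d k} → 3 ≤ k → k % 2 ≡ 1 →
           Gndk n (suc d) k ≡ copies (n / suc (suc d)) (H (suc d) k) ⊕ I (n % suc (suc d))
Gndk-odd {k = 1}                             (s≤s ()) _
Gndk-odd {k = 3}                             _ _   = refl
Gndk-odd {k = 4}                             _ ()
Gndk-odd {k = suc (suc (suc (suc (suc k))))} _ k-odd = if-T (≡⇒≡ᵇ _ 1 k-odd)

even-not-odd : ∀ {k} → k % 2 ≡ 0 → ¬ T (k % 2 ≡ᵇ 1)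
even-not-odd k-even t = case trans (sym k-even) (≡ᵇ⇒≡ _ 1 t) of λ ()

Gndk-even-small : ∀ {n d k} → 5 ≤ k → k % 2 ≡ 0 → n % suc (suc d) ≤ suc d ∸ k / 2 →
                  Gndk n (suc d) k ≡ copies (n / suc (suc d)) (H (suc d) k) ⊕ I (n % suc (suc d))
Gndk-even-small {k = k} (s≤s (s≤s (s≤s (s≤s (s≤s _))))) k-even small = trans (if-¬T (even-not-odd {k} k-even)) (if-T (≤⇒≤ᵇ small))

Gndk-even-large : ∀ {n d k} → 5 ≤ k → k % 2 ≡ 0 → suc d ∸ k / 2 < n % suc (suc d) →
                  Gndk n (suc d) k ≡ copies (n / suc (suc d) ∸ 1) (H (suc d) k) ⊕ Hstar (suc d) k
                                     ⊕ I ((n % suc (suc d) + k / 2) ∸ suc (suc d))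
Gndk-even-large {k = k} (s≤s (s≤s (s≤s (s≤s (s≤s _))))) k-even large =
  trans (if-¬T (even-not-odd {k} k-even)) (if-¬T (λ t → <⇒≱ large (≤ᵇ⇒≤ _ _ t)))

Gndk-4-small : ∀ {n d} → n % (2 * suc d) ≤ suc d →
               Gndk n (suc d) 4 ≡ copies (n / (2 * suc d)) (Hstar (suc d) 4) ⊕ I (n % (2 * suc d))
Gndk-4-small small = if-T (≤⇒≤ᵇ small)

Gndk-4-large : ∀ {n d} → suc d < n % (2 * suc d) →
               Gndk n (suc d) 4 ≡ copies (n / (2 * suc d)) (Hstar (suc d) 4) ⊕ star (suc d) ⊕ I (n % (2 * suc d) ∸ suc d ∸ 1)
Gndk-4-large large = if-¬T (λ t → <⇒≱ large (≤ᵇ⇒≤ _ _ t))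

copies-H-witness : ∀ {n d k q r} → 1 ≤ k → half k ≤ d → n ≡ q * suc d + r →
                   Witness n d k (q * half k) (copies q (H d k) ⊕ I r)
copies-H-witness {k = suc k} {q} 1≤k h≤d n≡ =
  Witness-cast (sym n≡) (≤-reflexive (sym (+-identityʳ _))) (Witness-⊕ (Witness-copies q (H-witness 1≤k h≤d)) I-witness)

witness-odd : ∀ {n d k} m q r → k ≡ 2 * m + 1 → k ≤ d → n ≡ q * suc d + r → r ≤ d →
              Witness n d k (m * q) (Gndk n d k)
witness-odd zero q r refl _ _ _ = I-witness
witness-odd {d = zero} (suc m) q r refl () _ _
witness-odd {n} {suc d} {k} (suc m) q r refl k≤d n≡ r≤d =
  subst (Witness n (suc d) k (suc m * q)) (sym graph)
    (Witness-cast refl (≤-reflexive high) (copies-H-witness {q = q} (s≤s z≤n) (≤-trans (half-≤ k) k≤d) n≡))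
  where
  graph : Gndk n (suc d) k ≡ copies q (H (suc d) k) ⊕ I r
  graph = divMod-subst {q = q} (λ q r → Gndk n (suc d) k ≡ copies q (H (suc d) k) ⊕ I r) n≡ (s≤s r≤d)
            (Gndk-odd {n} {d} {k} (+-monoˡ-≤ 1 (*-monoʳ-≤ 2 (s≤s z≤n))) ([2*m+1]%2≡1 (suc m)))
  high : suc m * q ≡ q * half k
  high = trans (*-comm (suc m) q) (cong (q *_) (sym (half-odd (suc m))))

witness-even-small : ∀ {n d k} m q r → k ≡ 2 * m → 3 ≤ m → k ≤ d → n ≡ q * suc d + r → r + m ≤ d →
                     Witness n d k ((m ∸ 1) * q) (Gndk n d k)
witness-even-small {d = zero} (suc _) q r refl (s≤s _) () _ _
witness-even-small {n} {suc d} {k} m q r refl 3≤m k≤d n≡ small =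
  subst (Witness n (suc d) k ((m ∸ 1) * q)) (sym graph)
    (Witness-cast refl (≤-reflexive high) (copies-H-witness {q = q} (≤-trans (s≤s z≤n) 5≤k) (≤-trans (half-≤ k) k≤d) n≡))
  where
  5≤k : 5 ≤ k
  5≤k = ≤-trans (n≤1+n 5) (*-monoʳ-≤ 2 3≤m)
  r≤ : r ≤ suc d ∸ k / 2
  r≤ = subst (λ x → r ≤ suc d ∸ x) (sym (2*m/2≡m m)) (m+n≤o⇒m≤o∸n r small)
  graph : Gndk n (suc d) k ≡ copies q (H (suc d) k) ⊕ I r
  graph = divMod-subst {q = q} (λ q r → r ≤ suc d ∸ k / 2 → Gndk n (suc d) k ≡ copies q (H (suc d) k) ⊕ I r)
            n≡ (s≤s (m+n≤o⇒m≤o r small)) (Gndk-even-small {n} {d} {k} 5≤k (2*m%2≡0 m)) r≤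
  high : (m ∸ 1) * q ≡ q * half k
  high = trans (*-comm (m ∸ 1) q) (cong (q *_) (sym (half-even m)))

witness-even-large : ∀ {n d k} m q r → k ≡ 2 * m → 3 ≤ m → k ≤ d → d < n → n ≡ q * suc d + r → r ≤ d → d < r + m →
                     Witness n d k ((m ∸ 1) * q + 1) (Gndk n d k)
witness-even-large {d = zero} (suc _) q r refl (s≤s _) () _ _ _ _
witness-even-large m zero r _ _ _ d<n refl r≤d _ = ⊥-elim (<⇒≱ d<n r≤d)
witness-even-large {n} {D@(suc d)} {k} (suc m) (suc q) r refl (s≤s 2≤m) k≤d _ n≡ r≤d D<r+m =
  subst (Witness n D k (m * suc q + 1)) (sym graph)
    (Witness-cast order (≤-reflexive high)
      (Witness-⊕ (Witness-copies q (H-witness (s≤s z≤n) (≤-trans (half-≤ k) k≤d)))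
                 (Witness-⊕ (Hstar-witness (m≤n⇒m≤1+n 2≤m) (m≤n⇒m≤1+n 1+m≤D)) I-witness)))
  where
  1+m≤D : suc m ≤ D
  1+m≤D = ≤-trans (m≤m+n (suc m) _) k≤d
  A = suc D
  D∸m<r : D ∸ k / 2 < r
  D∸m<r = subst (λ x → D ∸ x < r) (sym (2*m/2≡m (suc m)))
            (+-cancelʳ-≤ (suc m) _ r (subst (_≤ r + suc m) (cong suc (sym (m∸n+n≡m 1+m≤D))) D<r+m))
  graph : Gndk n D k ≡ copies q (H D k) ⊕ Hstar D k ⊕ I ((r + k / 2) ∸ suc D)
  graph = divMod-subst {q = suc q}
            (λ q r → D ∸ k / 2 < r → Gndk n D k ≡ copies (q ∸ 1) (H D k) ⊕ Hstar D k ⊕ I ((r + k / 2) ∸ suc D))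
            n≡ (s≤s r≤d) (Gndk-even-large {n} {d} {k} (≤-trans (n≤1+n 5) (*-monoʳ-≤ 2 (s≤s 2≤m))) (2*m%2≡0 (suc m))) D∸m<r
  order : q * A + ((A + (A ∸ suc m)) + ((r + k / 2) ∸ A)) ≡ n
  order = begin
    q * A + ((A + (A ∸ suc m)) + ((r + k / 2) ∸ A))  ≡⟨ cong (λ x → q * A + ((A + (A ∸ suc m)) + ((r + x) ∸ A))) (2*m/2≡m (suc m)) ⟩
    q * A + ((A + (A ∸ suc m)) + ((r + suc m) ∸ A))  ≡⟨ cong (q * A +_) (trans (+-assoc A _ _) (cong (A +_) ([a∸m]+[r+m∸a]≡r (m≤n⇒m≤1+n 1+m≤D) D<r+m))) ⟩
    q * A + (A + r)                                  ≡⟨ +-assoc (q * A) A r ⟨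
    q * A + A + r                                    ≡⟨ cong (_+ r) (+-comm (q * A) A) ⟩
    A + q * A + r                                    ≡⟨ n≡ ⟨
    n                                                ∎
    where open ≡-Reasoning
  high : m * suc q + 1 ≡ q * half k + (suc m + 0)
  high = trans (regroup m q) (cong (λ h → q * h + (suc m + 0)) (sym (half-even (suc m))))
    where
    regroup : ∀ m q → m * suc q + 1 ≡ q * m + (suc m + 0)
    regroup = solve-∀

witness-4-small : ∀ {n d k} q r → k ≡ 4 → k ≤ d → n ≡ 2 * q * d + r → r < 2 * d → r ≤ d →
                  Witness n d k (2 * q) (Gndk n d k)
witness-4-small {d = zero} q r refl ()
witness-4-small {n} {suc d} q r refl _ n≡ r<2D r≤D =
  subst (Witness n (suc d) 4 (2 * q)) (sym graph)
    (Witness-cast order (≤-reflexive (sym (trans (+-identityʳ _) (*-comm q 2))))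
      (Witness-⊕ (Witness-copies q (Hstar-witness {suc d} {2} ≤-refl (s≤s (s≤s z≤n)))) I-witness))
  where
  graph : Gndk n (suc d) 4 ≡ copies q (Hstar (suc d) 4) ⊕ I r
  graph = divMod-subst {q = q} (λ q r → r ≤ suc d → Gndk n (suc d) 4 ≡ copies q (Hstar (suc d) 4) ⊕ I r)
            (trans n≡ (cong (_+ r) (2*q*[1+d]≡q*[2*[1+d]] q d))) r<2D (Gndk-4-small {n} {d}) r≤D
  order : q * (suc (suc d) + d) + r ≡ n
  order = trans (cong (_+ r) (q*[2+d+d]≡2*q*[1+d] q d)) (sym n≡)

witness-4-large : ∀ {n d k} q r → k ≡ 4 → k ≤ d → n ≡ 2 * q * d + r → r < 2 * d → d < r →
                  Witness n d k (2 * q + 1) (Gndk n d k)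
witness-4-large {d = zero} q r refl ()
witness-4-large {n} {D@(suc d)} q r refl _ n≡ r<2D D<r =
  subst (Witness n D 4 (2 * q + 1)) (sym graph)
    (Witness-cast order (≤-reflexive (cong (_+ 1) (*-comm 2 q)))
      (Witness-⊕ (Witness-copies q (Hstar-witness {D} {2} ≤-refl (s≤s (s≤s z≤n))))
                 (Witness-⊕ (star-witness (n≤1+n 3)) I-witness)))
  where
  graph : Gndk n D 4 ≡ copies q (Hstar D 4) ⊕ star D ⊕ I (r ∸ D ∸ 1)
  graph = divMod-subst {q = q} (λ q r → D < r → Gndk n D 4 ≡ copies q (Hstar D 4) ⊕ star D ⊕ I (r ∸ D ∸ 1))
            (trans n≡ (cong (_+ r) (2*q*[1+d]≡q*[2*[1+d]] q d))) r<2D (Gndk-4-large {n} {d}) D<r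
  order : q * (suc D + d) + (suc D + (r ∸ D ∸ 1)) ≡ n
  order = begin
    q * (suc D + d) + (suc D + (r ∸ D ∸ 1))  ≡⟨ cong₂ _+_ (q*[2+d+d]≡2*q*[1+d] q d) (cong (suc D +_) (trans (∸-+-assoc r D 1) (cong (r ∸_) (+-comm D 1)))) ⟩
    2 * q * D + (suc D + (r ∸ suc D))        ≡⟨ cong (2 * q * D +_) (m+[n∸m]≡n D<r) ⟩
    2 * q * D + r                            ≡⟨ n≡ ⟨
    n                                        ∎
    where open ≡-Reasoning

Gndk-4-witness : ∀ {n d} → 4 ≤ d → ∃ λ c → Witness n d 4 c (Gndk n d 4)
Gndk-4-witness {n} {D@(suc d)} 4≤D = decide (r ≤? D)
  where
  q = n / (2 * D)
  r = n % (2 * D)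
  n≡ : n ≡ 2 * q * D + r
  n≡ = trans (m≡[m/n]*n+m%n n (2 * D)) (cong (_+ r) (sym (2*q*[1+d]≡q*[2*[1+d]] q d)))
  decide : Dec (r ≤ D) → ∃ λ c → Witness n D 4 c (Gndk n D 4)
  decide (yes r≤D) = _ , witness-4-small q r refl 4≤D n≡ (m%n<n n (2 * D)) r≤D
  decide (no r≰D)  = _ , witness-4-large q r refl 4≤D n≡ (m%n<n n (2 * D)) (≰⇒> r≰D)

Gndk-even-witness : ∀ {n d m} → 3 ≤ m → 2 * m ≤ d → d < n → ∃ λ c → Witness n d (2 * m) c (Gndk n d (2 * m))
Gndk-even-witness {n} {d} {m} 3≤m k≤d d<n = decide (r + m ≤? d)
  where
  r = n % suc d
  r≤d : r ≤ d
  r≤d = ≤-pred (m%n<n n (suc d))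
  decide : Dec (r + m ≤ d) → ∃ λ c → Witness n d (2 * m) c (Gndk n d (2 * m))
  decide (yes small) = _ , witness-even-small m (n / suc d) r refl 3≤m k≤d (m≡[m/n]*n+m%n n (suc d)) small
  decide (no large)  = _ , witness-even-large m (n / suc d) r refl 3≤m k≤d d<n (m≡[m/n]*n+m%n n (suc d)) r≤d (≰⇒> large)

Gndk-witness : ∀ {n d k} → 1 ≤ k → k ≤ d → d < n → ∃ λ c → Witness n d k c (Gndk n d k)
Gndk-witness {n} {d} {k} 1≤k k≤d d<n with parity k
... | even 0                     = case 1≤k of λ ()
... | even 1                     = 0 , I-witness
... | even 2                     = Gndk-4-witness k≤d
... | even m@(suc (suc (suc _))) = Gndk-even-witness (s≤s (s≤s (s≤s z≤n))) k≤d d<n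
... | odd m                      = _ , witness-odd m (n / suc d) (n % suc d) refl k≤d (m≡[m/n]*n+m%n n (suc d)) (≤-pred (m%n<n n (suc d)))

lemma2p2 : ∀ (n d k : ℕ) → 1 ≤ k → k ≤ d → d < n →
    V (Gndk n d k) ≡ n
    × ¬ HasPath (Gndk n d k) k
    × (∀ (t : ℕ) → Forces n d k t →
        -- k odd, k = 2m+1:  φ ≥ m q + 1
        (∀ (m q r : ℕ) → k ≡ 2 * m + 1 → n ≡ q * suc d + r → r ≤ d → m * q + 1 ≤ t)
        -- k = 2:  φ ≥ 1
        × (k ≡ 2 → 1 ≤ t)
        -- k = 4, n = 2qd + r, 0 ≤ r < 2d
        × (k ≡ 4 → ∀ (q r : ℕ) → n ≡ 2 * q * d + r → r < 2 * d →
             (r ≤ d → 2 * q + 1 ≤ t) × (d < r → 2 * q + 2 ≤ t))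
        -- k = 2m ≥ 6 even, n = q(d+1) + r, 0 ≤ r ≤ d;  (k-2)/2 = m-1
        × (∀ (m q r : ℕ) → k ≡ 2 * m → 3 ≤ m → n ≡ q * suc d + r → r ≤ d →
             (r + m ≤ d → (m ∸ 1) * q + 1 ≤ t) × (d < r + m → (m ∸ 1) * q + 2 ≤ t)))
lemma2p2 n d k 1≤k k≤d d<n = order w , pathFree w , λ t forces →
    (λ m q r k≡ n≡ r≤d → exceeds (witness-odd m q r k≡ k≤d n≡ r≤d) forces)
  , (λ _ → ≤-trans (m≤n+m 1 _) (exceeds w forces))
  , (λ k≡4 q r n≡ r<2d →
         (λ r≤d → exceeds (witness-4-small q r k≡4 k≤d n≡ r<2d r≤d) forces)
       , (λ d<r → +1+1 (exceeds (witness-4-large q r k≡4 k≤d n≡ r<2d d<r) forces)))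
  , λ m q r k≡ 3≤m n≡ r≤d →
         (λ small → exceeds (witness-even-small m q r k≡ 3≤m k≤d n≡ small) forces)
       , (λ large → +1+1 (exceeds (witness-even-large m q r k≡ 3≤m k≤d d<n n≡ r≤d large) forces))
  where
  open Witness
  w = proj₂ (Gndk-witness 1≤k k≤d d<n)
  +1+1 : ∀ {x t} → x + 1 + 1 ≤ t → x + 2 ≤ t
  +1+1 {x} {t} = subst (_≤ t) (+-assoc x 1 1)
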